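{- The axiom $p>p$ is $\kappa_\emptyset$-persistent: for every conditional Esakia space $\mathbb X$ on which $p>p$ is valid, $p>p$ is also valid on its empty fill-in $\kappa_\emptyset(\mathbb X)$.
   Context: Formulas: $\phi::=p\mid\bot\mid\phi\wedge\phi\mid\phi\vee\phi\mid\phi\to\phi\mid\phi>\phi$. An Esakia space is $(X,\le,\tau)$ with $(X,\le)$ a nonempty poset, $\tau$ compact, such that if $x\not\le y$ some clopen upset contains $x$ but not $y$, and ${\downarrow}a$ is clopen for clopen $a$. A conditional Esakia space $\mathbb X=(X,\le,\tau,\mathcal R)$ adds relations $\{R_a: a\text{ clopen upset}\}$ with: $\{x:R_a[x]\subseteq b\}$ clopen for clopen upsets $a,b$; $({\le}\circ R_a\circ{\le})=R_a$; each $R_a[x]=\{y:xR_ay\}$ closed. Validity on $\mathbb X$ uses only valuations into clopen upsets. A conditional Kripke frame is $(X,\le,\{R_a\}_{a\text{ upset}})$ with relations indexed by all upsets satisfying: $x\le yR_az$ implies $xR_aw\le z$ for some $w$; validity uses all upset valuations. Truth of $\phi>\psi$ at $x$: all $y$ with $xR_{V(\phi)}y$ satisfy $\psi$; other connectives by intuitionistic Kripke clauses. The empty fill-in $\kappa_\emptyset(\mathbb X)$ is the conditional Kripke frame $(X,\le,\mathcal R')$ with $R'_a=R_a$ for clopen upsets $a$ and $R'_a=\emptyset$ for every non-clopen upset $a$. -}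

module Defs where

open import Data.Nat using (ℕ)
open import Data.Empty using (⊥)
open import Data.Unit using (⊤)
open import Data.Product using (Σ; ∃; _×_; _,_; proj₁; proj₂)
open import Data.Sum using (_⊎_)
open import Data.List using (List)
open import Data.List.Relation.Unary.Any using (Any)
open import Relation.Nullary using (¬_)
open import Relation.Binary.PropositionalEquality using (_≡_)
open import Relation.Binary.Structures using (IsPartialOrder)

Subset : Set → Set₁
Subset X = X → Set

_≐_ : {X : Set} → Subset X → Subset X → Set
a ≐ b = ∀ x → (a x → b x) × (b x → a x)

record Topology (X : Set) : Set₁ where
  field
    Open      : Subset X → Set
    open-ext  : ∀ {a b} → a ≐ b → Open a → Open b
    open-full : Open (λ _ → ⊤)
    open-∩    : ∀ {a b} → Open a → Open b → Open (λ x → a x × b x)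
    open-⋃    : (I : Set) (U : I → Subset X) → (∀ i → Open (U i)) →
                Open (λ x → Σ I (λ i → U i x))

  Closed : Subset X → Set
  Closed a = Open (λ x → ¬ a x)

  Clopen : Subset X → Set
  Clopen a = Open a × Closed a

  Compact : Set₁
  Compact = (I : Set) (U : I → Subset X) → (∀ i → Open (U i)) →
            (∀ x → Σ I (λ i → U i x)) →
            Σ (List I) (λ is → ∀ x → Any (λ i → U i x) is)

module _ {X : Set} (_≤_ : X → X → Set) where

  IsUpset : Subset X → Set
  IsUpset a = ∀ {x y} → x ≤ y → a x → a y

  ↓ : Subset X → Subset X
  ↓ a x = Σ X (λ y → x ≤ y × a y)

record EsakiaSpace : Set₁ where
  field
    X          : Set
    _≤_        : X → X → Set
    isPO       : IsPartialOrder _≡_ _≤_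
    nonempty   : X
    τ          : Topology X
  open Topology τ public
  IsClopenUpset : Subset X → Set
  IsClopenUpset a = Clopen a × IsUpset _≤_ a
  field
    compact    : Compact
    separation : ∀ {x y} → ¬ (x ≤ y) →
                 Σ (Subset X) (λ a → IsClopenUpset a × a x × ¬ a y)
    ↓-clopen   : ∀ {a} → Clopen a → Clopen (↓ _≤_ a)

-- The relations R_a are indexed by clopen
-- upsets a, i.e. by a subset together with a proof that it is a clopen
-- upset; R-ext says R_a only depends on the subset a (extensionally).

record CondEsakiaSpace : Set₁ where
  field
    esakia : EsakiaSpace
  open EsakiaSpace esakia public
  field
    R        : (a : Subset X) → IsClopenUpset a → X → X → Set
    R-ext    : ∀ {a b} (ca : IsClopenUpset a) (cb : IsClopenUpset b) →
               a ≐ b → ∀ {x y} → R a ca x y → R b cb x y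
    R-clopen : ∀ {a b} (ca : IsClopenUpset a) → IsClopenUpset b →
               Clopen (λ x → ∀ y → R a ca x y → b y)
    R-≤      : ∀ {a} (ca : IsClopenUpset a) {x y} →
               (Σ X λ x' → Σ X λ y' → x ≤ x' × R a ca x' y' × y' ≤ y)
                 → R a ca x y
    ≤-R      : ∀ {a} (ca : IsClopenUpset a) {x y} → R a ca x y →
               (Σ X λ x' → Σ X λ y' → x ≤ x' × R a ca x' y' × y' ≤ y)
    R-closed : ∀ {a} (ca : IsClopenUpset a) x → Closed (R a ca x)

-- Conditional Kripke frames: relations indexed by all upsets
-- (R is given on all subsets; only its values on upsets matter).

record CondKripkeFrame : Set₁ where
  field
    X     : Set
    _≤_   : X → X → Set
    isPO  : IsPartialOrder _≡_ _≤_
    R     : Subset X → X → X → Set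
    back  : ∀ (a : Subset X) → IsUpset _≤_ a → ∀ {x y z} →
            x ≤ y → R a y z → Σ X (λ w → R a x w × w ≤ z)

data Form : Set where
  var  : ℕ → Form
  ⊥'   : Form
  _∧'_ : Form → Form → Form
  _∨'_ : Form → Form → Form
  _⇒_  : Form → Form → Form
  _▷_  : Form → Form → Form

module Sem {X : Set} (_≤_ : X → X → Set) (R : Subset X → X → X → Set)
           (V : ℕ → Subset X) where

  ⟦_⟧ : Form → Subset X
  ⟦ var n ⟧ x  = V n x
  ⟦ ⊥' ⟧ x     = ⊥
  ⟦ φ ∧' ψ ⟧ x = ⟦ φ ⟧ x × ⟦ ψ ⟧ x
  ⟦ φ ∨' ψ ⟧ x = ⟦ φ ⟧ x ⊎ ⟦ ψ ⟧ x
  ⟦ φ ⇒ ψ ⟧ x  = ∀ y → x ≤ y → ⟦ φ ⟧ y → ⟦ ψ ⟧ y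
  ⟦ φ ▷ ψ ⟧ x  = ∀ y → R ⟦ φ ⟧ x y → ⟦ ψ ⟧ y

KValid : CondKripkeFrame → Form → Set₁
KValid F φ = (V : ℕ → Subset X) → (∀ n → IsUpset _≤_ (V n)) →
             ∀ x → Sem.⟦_⟧ _≤_ R V φ x
  where open CondKripkeFrame F

-- On a conditional Esakia space, R_{V(φ)} is R at the clopen upset V(φ)
-- (every truth set under a clopen-upset valuation is a clopen upset).
-- We use the relation "x R_a y for a a clopen upset", which by R-ext
-- does not depend on the proof that a is a clopen upset.
module _ (𝕏 : CondEsakiaSpace) where
  open CondEsakiaSpace 𝕏

  RC : Subset X → X → X → Set
  RC a x y = Σ (IsClopenUpset a) (λ c → R a c x y)

EValid : CondEsakiaSpace → Form → Set₁
EValid 𝕏 φ = (V : ℕ → Subset X) → (∀ n → IsClopenUpset (V n)) →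
             ∀ x → Sem.⟦_⟧ _≤_ (RC 𝕏) V φ x
  where open CondEsakiaSpace 𝕏

-- The empty fill-in: R'_a = R_a if a is a clopen upset, and R'_a = ∅
-- otherwise (expressed without case distinction: x R'_a y iff a is a
-- clopen upset and x R_a y).

κ∅ : CondEsakiaSpace → CondKripkeFrame
κ∅ 𝕏 = record
  { X = X ; _≤_ = _≤_ ; isPO = isPO
  ; R = λ a x y → Σ (IsClopenUpset a) (λ c → R a c x y)
  ; back = λ a up {x} {y} {z} x≤y (c , r) →
      z , (c , R-≤ c (y , z , x≤y , r , IsPartialOrder.refl isPO)) ,
      IsPartialOrder.refl isPO
  }
  where open CondEsakiaSpace 𝕏

p▷p : Form
p▷p = var 0 ▷ var 0

module Submission where

open import Defs
open import Data.Product using (_,_)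

-- A step of the fill-in along V(p) exists only when V(p) is a clopen upset,
-- and then the constant valuation V(p) is admissible on 𝕏 itself.
lemma5p3 : (𝕏 : CondEsakiaSpace) → EValid 𝕏 p▷p → KValid (κ∅ 𝕏) p▷p
lemma5p3 𝕏 valid V _ x y (clopenUpset , xRy) =
  valid (λ _ → V 0) (λ _ → clopenUpset) x y (clopenUpset , xRy)
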